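{- If $X$ is a finite set, then the $C$-algebra $\mathbb{3}^{X}$ is atomic.
   Context: $\mathbb{3}$ denotes McCarthy's three-valued $C$-algebra on $\{T,F,U\}$ with operations: $\neg T = F$, $\neg F = T$, $\neg U = U$; $T\wedge x = x$, $F \wedge x = F$, $U \wedge x = U$; $T \vee x = T$, $F \vee x = x$, $U \vee x = U$. $\mathbb{3}^{X}$ has pointwise operations with constants $\mathbf{T},\mathbf{F},\mathbf{U}$. Order: $a \leq b$ iff $a \vee b = b$. An atom is $a \neq \mathbf{F}$ such that every $b$ with $\mathbf{F}\leq b\leq a$, $b\neq a$ equals $\mathbf{F}$. For finitely many atoms $a_1,\dots,a_N$: if for every bijection $\sigma$ of $\{1,\dots,N\}$, $a_{\sigma(1)}\vee\cdots\vee a_{\sigma(N)} = a_1\vee\cdots\vee a_N$, then $\bigoplus_{i=1}^N a_i$ exists and equals this value. A $C$-algebra $M$ with $T,F,U$ is atomic if for every $a \in M$ with $a \neq F$ there is a finite set of atoms $\{a_1,\dots,a_N\}$ with $\bigoplus_{i=1}^N a_i$ existing and equal to $a$. -}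

module Defs where

open import Data.Nat using (ℕ; zero; suc)
open import Data.Fin using (Fin; zero; suc)
open import Data.Product using (Σ; _×_; _,_)
open import Relation.Binary.PropositionalEquality using (_≡_)
open import Relation.Nullary using (¬_)
open import Function.Bundles using (_⤖_; Bijection)

-- McCarthy's three truth values
data 𝟛 : Set where
  T F U : 𝟛

¬₃_ : 𝟛 → 𝟛
¬₃ T = F
¬₃ F = T
¬₃ U = U

_∧₃_ : 𝟛 → 𝟛 → 𝟛
T ∧₃ x = x
F ∧₃ x = F
U ∧₃ x = U

_∨₃_ : 𝟛 → 𝟛 → 𝟛
T ∨₃ x = T
F ∨₃ x = x
U ∨₃ x = U

-- The C-algebra 3^X for a finite set X, X represented as Fin n.
3^ : ℕ → Set
3^ n = Fin n → 𝟛

module _ {n : ℕ} where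

  _≈_ : 3^ n → 3^ n → Set
  a ≈ b = ∀ x → a x ≡ b x

  ¬ᵖ_ : 3^ n → 3^ n
  (¬ᵖ a) x = ¬₃ a x

  _∧ᵖ_ : 3^ n → 3^ n → 3^ n
  (a ∧ᵖ b) x = a x ∧₃ b x

  _∨ᵖ_ : 3^ n → 3^ n → 3^ n
  (a ∨ᵖ b) x = a x ∨₃ b x

  𝐓 𝐅 𝐔 : 3^ n
  𝐓 _ = T
  𝐅 _ = F
  𝐔 _ = U

  _≤ᵖ_ : 3^ n → 3^ n → Set
  a ≤ᵖ b = (a ∨ᵖ b) ≈ b

  IsAtom : 3^ n → Set
  IsAtom a = ¬ (a ≈ 𝐅) ×
             (∀ b → 𝐅 ≤ᵖ b → b ≤ᵖ a → ¬ (b ≈ a) → b ≈ 𝐅)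

  -- iterated join a₀ ∨ (a₁ ∨ (… ∨ a_{N-1})) of a family indexed by Fin N
  -- (right-nested; for N = 0 it is 𝐅, never used for the conclusion a ≠ 𝐅)
  ⋁ : (N : ℕ) → (Fin N → 3^ n) → 3^ n
  ⋁ zero    f = 𝐅
  ⋁ (suc zero) f = f zero
  ⋁ (suc (suc N)) f = f zero ∨ᵖ ⋁ (suc N) (λ i → f (suc i))

  -- ⊕_{i} a_i exists and equals c: every reordering of the join equals
  -- the join in the given order, and that join is c.
  ⊕Is : (N : ℕ) → (Fin N → 3^ n) → 3^ n → Set
  ⊕Is N a c = (∀ (σ : Fin N ⤖ Fin N) →
                 ⋁ N (λ i → a (Bijection.to σ i)) ≈ ⋁ N a)
              × (⋁ N a ≈ c)

  FinSetOfAtoms : (N : ℕ) → (Fin N → 3^ n) → Set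
  FinSetOfAtoms N a = (∀ i → IsAtom (a i)) ×
                      (∀ i j → a i ≈ a j → i ≡ j)

IsAtomic3^ : ℕ → Set
IsAtomic3^ n = ∀ (a : 3^ n) → ¬ (a ≈ 𝐅) →
  Σ ℕ λ N → Σ (Fin N → 3^ n) λ as →
    FinSetOfAtoms N as × ⊕Is N as a

module Submission where

-- Every a ≠ 𝐅 in 3^X (X = Fin n) is the ⊕ of its "point restrictions":
-- for x in the support of a (a x ≠ F), restrict a x takes the value a x at x
-- and F elsewhere.
--
--   * Enumerating a decidable subset of Fin n gives the support of a as a
--     finite family indexed by Fin N, without repetitions.
--   * Below a point restriction there is only 𝐅 and itself, so each
--     restrict a x with a x ≠ F is an atom; distinct points give distinct
--     atoms.
--   * Joins in 3^X are computed pointwise.  At a point y all restrictions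
--     take a value in {F, a y}; if a y = F the join is F, otherwise a y is
--     absorbing for ∨₃ and is hit by the restriction at y itself.  Hence the
--     join over ANY surjective reindexing of the atoms equals a, which gives
--     both the permutation invariance required by ⊕ and its value a.

open import Defs
open import Level using (0ℓ)
open import Data.Nat using (ℕ; zero; suc)
open import Data.Fin using (Fin; zero; suc; _≟_)
open import Data.Fin.Properties using (suc-injective)
open import Data.Product using (Σ; _,_; proj₁; proj₂)
open import Data.Sum using (_⊎_; inj₁; inj₂; [_,_]′)
open import Data.Empty using (⊥-elim)
open import Function using (id)
open import Function.Bundles using (Bijection)
open import Relation.Nullary using (¬_; Dec; yes; no)
open import Relation.Nullary.Decidable using (¬?)
open import Relation.Unary using (Pred; Decidable)
open import Relation.Binary.PropositionalEquality
  using (_≡_; refl; sym; trans; cong; subst)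

record Enumeration {n : ℕ} (P : Pred (Fin n) 0ℓ) : Set where
  field
    size      : ℕ
    index     : Fin size → Fin n
    injective : ∀ i j → index i ≡ index j → i ≡ j
    sound     : ∀ i → P (index i)
    complete  : ∀ x → P x → Σ (Fin size) λ i → index i ≡ x

enumerate : ∀ {n} (P : Pred (Fin n) 0ℓ) → Decidable P → Enumeration P
enumerate {zero}  P P? = record
  { size = zero ; index = λ () ; injective = λ () ; sound = λ () ; complete = λ () }
enumerate {suc n} P P? with P? zero | enumerate (λ x → P (suc x)) (λ x → P? (suc x))
... | no ¬P0 | E = record
  { size      = size
  ; index     = λ i → suc (index i)
  ; injective = λ i j eq → injective i j (suc-injective eq)
  ; sound     = sound
  ; complete  = λ { zero P0 → ⊥-elim (¬P0 P0)
                  ; (suc x) Px → let (i , eq) = complete x Px in i , cong suc eq } }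
  where open Enumeration E
... | yes P0 | E = record
  { size      = suc size
  ; index     = λ { zero → zero ; (suc i) → suc (index i) }
  ; injective = λ { zero zero _ → refl ; zero (suc _) () ; (suc _) zero ()
                  ; (suc i) (suc j) eq → cong suc (injective i j (suc-injective eq)) }
  ; sound     = λ { zero → P0 ; (suc i) → sound i }
  ; complete  = λ { zero _ → zero , refl
                  ; (suc x) Px → let (i , eq) = complete x Px in suc i , cong suc eq } }
  where open Enumeration E

_≟F : (t : 𝟛) → Dec (t ≡ F)
T ≟F = no λ ()
F ≟F = yes refl
U ≟F = no λ ()

absorbing : ∀ v → ¬ v ≡ F → ∀ x → v ∨₃ x ≡ v
absorbing T _   x = refl
absorbing F v≢F x = ⊥-elim (v≢F refl)
absorbing U _   x = refl

∨₃-below : ∀ t v → t ∨₃ v ≡ v → t ≡ F ⊎ t ≡ v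
∨₃-below T v eq = inj₂ eq
∨₃-below F v _  = inj₁ refl
∨₃-below U v eq = inj₂ eq

≤-pointwise : ∀ {n} {b c : 3^ n} → b ≤ᵖ c → ∀ y → b y ≡ F ⊎ b y ≡ c y
≤-pointwise {b = b} {c} b≤c y = ∨₃-below (b y) (c y) (b≤c y)

⋁₃ : (N : ℕ) → (Fin N → 𝟛) → 𝟛
⋁₃ zero          g = F
⋁₃ (suc zero)    g = g zero
⋁₃ (suc (suc N)) g = g zero ∨₃ ⋁₃ (suc N) (λ i → g (suc i))

⋁-pointwise : ∀ {n} N (f : Fin N → 3^ n) y → ⋁ N f y ≡ ⋁₃ N (λ i → f i y)
⋁-pointwise zero          f y = refl
⋁-pointwise (suc zero)    f y = refl
⋁-pointwise (suc (suc N)) f y =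
  cong (f zero y ∨₃_) (⋁-pointwise (suc N) (λ i → f (suc i)) y)

⋁₃-all-F : ∀ N (g : Fin N → 𝟛) → (∀ i → g i ≡ F) → ⋁₃ N g ≡ F
⋁₃-all-F zero          g allF = refl
⋁₃-all-F (suc zero)    g allF = allF zero
⋁₃-all-F (suc (suc N)) g allF =
  trans (cong (_∨₃ ⋁₃ (suc N) (λ i → g (suc i))) (allF zero))
        (⋁₃-all-F (suc N) (λ i → g (suc i)) (λ i → allF (suc i)))

⋁₃-hit : ∀ {v} → (∀ x → v ∨₃ x ≡ v) →
         ∀ N (g : Fin N → 𝟛) → (∀ i → g i ≡ F ⊎ g i ≡ v) →
         (k : Fin N) → g k ≡ v → ⋁₃ N g ≡ v
⋁₃-hit absorb (suc zero)    g vals zero    gk≡v = gk≡v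
⋁₃-hit absorb (suc (suc N)) g vals zero    gk≡v =
  trans (cong (_∨₃ ⋁₃ (suc N) (λ i → g (suc i))) gk≡v) (absorb _)
⋁₃-hit absorb (suc (suc N)) g vals (suc k) gk≡v with vals zero
... | inj₁ g0≡F =
  trans (cong (_∨₃ ⋁₃ (suc N) (λ i → g (suc i))) g0≡F)
        (⋁₃-hit absorb (suc N) (λ i → g (suc i)) (λ i → vals (suc i)) k gk≡v)
... | inj₂ g0≡v =
  trans (cong (_∨₃ ⋁₃ (suc N) (λ i → g (suc i))) g0≡v) (absorb _)

module _ {n : ℕ} where

  restrict : 3^ n → Fin n → 3^ n
  restrict a x y with y ≟ x
  ... | yes _ = a y
  ... | no  _ = F

  restrict-at : ∀ a x → restrict a x x ≡ a x
  restrict-at a x with x ≟ x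
  ... | yes _   = refl
  ... | no  x≢x = ⊥-elim (x≢x refl)

  restrict-off : ∀ a x y → ¬ y ≡ x → restrict a x y ≡ F
  restrict-off a x y y≢x with y ≟ x
  ... | yes y≡x = ⊥-elim (y≢x y≡x)
  ... | no  _   = refl

  restrict-values : ∀ a x y → restrict a x y ≡ F ⊎ restrict a x y ≡ a y
  restrict-values a x y with y ≟ x
  ... | yes _ = inj₂ refl
  ... | no  _ = inj₁ refl

  -- The only elements below a point restriction are 𝐅 and itself: away from
  -- x such an element is F, and at x it is F or a x.
  below-restrict : ∀ {a x b} → b ≤ᵖ restrict a x → b ≈ 𝐅 ⊎ b ≈ restrict a x
  below-restrict {a} {x} {b} b≤r = at-x (≤-pointwise b≤r x)
    where
    off-point : ∀ y → ¬ y ≡ x → b y ≡ F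
    off-point y y≢x =
      [ id , (λ by≡r → trans by≡r (restrict-off a x y y≢x)) ]′ (≤-pointwise b≤r y)

    at-x : b x ≡ F ⊎ b x ≡ restrict a x x → b ≈ 𝐅 ⊎ b ≈ restrict a x
    at-x (inj₁ bx≡F) = inj₁ λ y → vanish y (y ≟ x)
      where
      vanish : ∀ y → Dec (y ≡ x) → b y ≡ F
      vanish y (yes y≡x) = subst (λ z → b z ≡ F) (sym y≡x) bx≡F
      vanish y (no  y≢x) = off-point y y≢x
    at-x (inj₂ bx≡r) = inj₂ λ y → agree y (y ≟ x)
      where
      agree : ∀ y → Dec (y ≡ x) → b y ≡ restrict a x y
      agree y (yes y≡x) = subst (λ z → b z ≡ restrict a x z) (sym y≡x) bx≡r
      agree y (no  y≢x) = trans (off-point y y≢x) (sym (restrict-off a x y y≢x))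

  restrict-atom : ∀ {a x} → ¬ a x ≡ F → IsAtom (restrict a x)
  restrict-atom {a} {x} ax≢F = nonzero , minimal
    where
    nonzero : ¬ restrict a x ≈ 𝐅
    nonzero r≈𝐅 = ax≢F (trans (sym (restrict-at a x)) (r≈𝐅 x))

    minimal : ∀ b → 𝐅 ≤ᵖ b → b ≤ᵖ restrict a x → ¬ b ≈ restrict a x → b ≈ 𝐅
    minimal b _ b≤r b≉r = [ id , (λ b≈r → ⊥-elim (b≉r b≈r)) ]′ (below-restrict b≤r)

  restrict-injective : ∀ {a x x′} → ¬ a x ≡ F →
                       restrict a x ≈ restrict a x′ → x ≡ x′
  restrict-injective {a} {x} {x′} ax≢F r≈r′ with x ≟ x′
  ... | yes x≡x′ = x≡x′
  ... | no  x≢x′ = ⊥-elim (ax≢F ax≡F)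
    where
    ax≡F : a x ≡ F
    ax≡F = trans (sym (restrict-at a x))
                 (trans (r≈r′ x) (restrict-off a x′ x x≢x′))

  Support : 3^ n → Pred (Fin n) 0ℓ
  Support a x = ¬ a x ≡ F

  support? : ∀ a → Decidable (Support a)
  support? a x = ¬? (a x ≟F)

  module Decomposition (a : 3^ n) (E : Enumeration (Support a)) where
    open Enumeration E

    atoms : Fin size → 3^ n
    atoms i = restrict a (index i)

    -- At a point y, the join along a surjective reindexing τ equals a y:
    -- if a y = F all terms are F, otherwise the term at y itself is a y.
    join-at : (τ : Fin size → Fin size) → (∀ k → Σ (Fin size) λ i → τ i ≡ k) →
              ∀ y → Dec (a y ≡ F) → ⋁₃ size (λ i → atoms (τ i) y) ≡ a y
    join-at τ surj y (yes ay≡F) =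
      trans (⋁₃-all-F size (λ i → atoms (τ i) y)
                      (λ i → [ id , (λ e → trans e ay≡F) ]′ (values i)))
            (sym ay≡F)
      where
      values : ∀ i → atoms (τ i) y ≡ F ⊎ atoms (τ i) y ≡ a y
      values i = restrict-values a (index (τ i)) y
    join-at τ surj y (no ay≢F) =
      ⋁₃-hit (absorbing (a y) ay≢F) size (λ i → atoms (τ i) y)
             (λ j → restrict-values a (index (τ j)) y) i hit
      where
      k : Fin size
      k = proj₁ (complete y ay≢F)

      i : Fin size
      i = proj₁ (surj k)

      index-τi≡y : index (τ i) ≡ y
      index-τi≡y = trans (cong index (proj₂ (surj k))) (proj₂ (complete y ay≢F))

      hit : atoms (τ i) y ≡ a y
      hit = subst (λ x → restrict a x y ≡ a y) (sym index-τi≡y) (restrict-at a y)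

    join-surjective : (τ : Fin size → Fin size) →
                      (∀ k → Σ (Fin size) λ i → τ i ≡ k) →
                      ⋁ size (λ i → atoms (τ i)) ≈ a
    join-surjective τ surj y =
      trans (⋁-pointwise size (λ i → atoms (τ i)) y) (join-at τ surj y (a y ≟F))

    -- In particular ⊕ of the atoms exists (every reordering is a bijection,
    -- hence surjective) and equals a.
    ⊕-atoms : ⊕Is size atoms a
    ⊕-atoms = (λ σ y → trans (reordered σ y) (sym (in-order y))) , in-order
      where
      in-order : ⋁ size atoms ≈ a
      in-order = join-surjective id (λ k → k , refl)

      reordered : ∀ σ → ⋁ size (λ i → atoms (Bijection.to σ i)) ≈ a
      reordered σ = join-surjective (Bijection.to σ) (Bijection.strictlySurjective σ)

    atoms-are-distinct-atoms : FinSetOfAtoms size atoms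
    atoms-are-distinct-atoms =
      (λ i → restrict-atom (sound i)) ,
      (λ i j atoms≈ → injective i j (restrict-injective (sound i) atoms≈))

theorem2p34 : (n : ℕ) → IsAtomic3^ n
theorem2p34 n a _ = size , atoms , atoms-are-distinct-atoms , ⊕-atoms
  where
  E : Enumeration (Support a)
  E = enumerate (Support a) (support? a)

  open Enumeration E using (size)
  open Decomposition a E
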